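{- Let $S,P,Q$ be pairwise disjoint finite sets and $\mathcal M_{SP},\mathcal M_{PQ}$ matroids on $S\uplus P$, $P\uplus Q$ with $\mathcal M_{SP}\circ P=\mathcal M^*_{PQ}\circ P$ and $\mathcal M_{SP}\times P=\mathcal M^*_{PQ}\times P$. Then: \begin{enumerate} \item $(\mathcal M_{SP}\leftrightarrow\mathcal M_{PQ})\circ S=\mathcal M_{SP}\circ S$ and $(\mathcal M_{SP}\leftrightarrow\mathcal M_{PQ})\times S=\mathcal M_{SP}\times S$; \item $\mathcal M^*_{SP}\circ P=\mathcal M_{PQ}\circ P$, $\mathcal M^*_{SP}\times P=\mathcal M_{PQ}\times P$, and $(\mathcal M_{SP}\leftrightarrow\mathcal M_{PQ})\circ Q=\mathcal M_{PQ}\circ Q$, $(\mathcal M_{SP}\leftrightarrow\mathcal M_{PQ})\times Q=\mathcal M_{PQ}\times Q$. \end{enumerate}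
   Context: For a matroid $\mathcal M$ on $X$ and $T\subseteq X$: $\mathcal M\circ T$ is the restriction to $T$ (delete $X-T$), $\mathcal M\times T$ the contraction to $T$ (contract $X-T$); $\mathcal M^*$ is the dual. $\mathbf 0_X$ is the matroid on $X$ whose only base is $\emptyset$. For matroids on the same set, $\mathcal M_1\vee\mathcal M_2$ has as bases the maximal sets $b_1\cup b_2$ with $b_i$ a base of $\mathcal M_i$. The linking is $\mathcal M_{SP}\leftrightarrow\mathcal M_{PQ}:=((\mathcal M_{SP}\oplus\mathbf 0_Q)\vee(\mathcal M_{PQ}\oplus\mathbf 0_S))\times(S\uplus Q)$. -}

module Defs where

open import Data.Nat using (ℕ)
open import Data.Fin using (Fin)
open import Data.Fin.Subset
open import Data.Product using (Σ; ∃; _×_; _,_)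
open import Relation.Binary.PropositionalEquality using (_≡_)

-- A set system on the finite universe Fin n, given by its family of bases.
Family : ℕ → Set₁
Family n = Subset n → Set

module _ {n : ℕ} where

  record IsMatroid (X : Subset n) (B : Family n) : Set where
    field
      base⊆ground : ∀ {b} → B b → b ⊆ X
      base-exists : ∃ λ b → B b
      exchange    : ∀ {b₁ b₂ x} → B b₁ → B b₂ → x ∈ b₁ → x ∉ b₂ →
                    ∃ λ y → y ∈ b₂ × y ∉ b₁ × B ((b₁ - x) ∪ ⁅ y ⁆)

  infix 4 _≐_
  _≐_ : Family n → Family n → Set
  F ≐ G = ∀ b → (F b → G b) × (G b → F b)

  Maximal : Family n → Family n
  Maximal F c = F c × (∀ d → F d → c ⊆ d → d ⊆ c)

  Indep : Family n → Family n
  Indep B i = ∃ λ b → B b × i ⊆ b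

  dual : Subset n → Family n → Family n
  dual X B c = ∃ λ b → B b × c ≡ X ─ b

  -- Restriction M ∘ T (delete X − T): bases are maximal independent subsets of T.
  restrict : Family n → Subset n → Family n
  restrict B T = Maximal (λ i → Indep B i × i ⊆ T)

  -- Contraction M × T (contract X − T): bases are b ∩ T where b is a base of M
  -- such that b ∩ (X − T) is a base of M ∘ (X − T).
  contract : Subset n → Family n → Subset n → Family n
  contract X B T c = ∃ λ b → B b × restrict B (X ─ T) (b ∩ (X ─ T)) × c ≡ b ∩ T

  zeroM : Family n
  zeroM c = c ≡ ⊥

  dsum : Family n → Family n → Family n
  dsum B₁ B₂ c = ∃ λ b₁ → ∃ λ b₂ → B₁ b₁ × B₂ b₂ × c ≡ b₁ ∪ b₂

  union : Family n → Family n → Family n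
  union B₁ B₂ = Maximal (λ c → ∃ λ b₁ → ∃ λ b₂ → B₁ b₁ × B₂ b₂ × c ≡ b₁ ∪ b₂)

  -- Linking M_SP ↔ M_PQ := ((M_SP ⊕ 0_Q) ∨ (M_PQ ⊕ 0_S)) × (S ⊎ Q),
  -- the matroid union living on ground S ∪ P ∪ Q.
  link : (S P Q : Subset n) → Family n → Family n → Family n
  link S P Q MSP MPQ =
    contract (S ∪ P ∪ Q) (union (dsum MSP zeroM) (dsum MPQ zeroM)) (S ∪ Q)

module Submission where

-- Write A = 𝓜_SP and B = 𝓜_PQ.  The dualities (M ∘ T)* = M* × T and (M × T)* = M* ∘ T
-- turn the hypotheses into A × P = (B ∘ P)* and A ∘ P = (B × P)*, which gives the P-part
-- of (ii).  A base of the linking is the (S ∪ Q)-part of a base a ∪ b of A ∨ B whose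
-- P-part is a base of (A ∨ B) ∘ P; as P itself is independent in A ∨ B, this means
-- P ⊆ a ∪ b.  Conversely, if a ∩ P and b ∩ P are complementary in P then a and b are
-- disjoint, so a ∪ b is a base of A ∨ B.  Starting from a base of A ∘ S (resp. A × S),
-- the hypotheses produce such a complementary base b of B; this identifies the independent
-- sets of the linking inside S with those of A, and its contraction to S with A × S.
-- Exchanging the roles of S, A and Q, B gives the statements about Q.

open import Data.Empty using (⊥-elim)
open import Data.Fin using (Fin; _≟_)
open import Data.Fin.Subset
open import Data.Fin.Subset.Properties
open import Data.Nat using (ℕ; zero; suc; _+_; _≤_; _<_)
open import Data.Nat.Properties hiding (_≟_)
open import Data.Product using (∃; _×_; _,_; proj₁; proj₂)
open import Data.Sum using (inj₁; inj₂)
open import Data.Vec using ([]; _∷_; here; there)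
open import Function using (_∘_)
open import Relation.Binary.PropositionalEquality
open import Relation.Nullary using (¬_; yes; no)
open import Relation.Nullary.Decidable using (¬¬-excluded-middle; decidable-stable)

open import Defs

private variable
  n : ℕ

Disjoint : Subset n → Subset n → Set
Disjoint p q = ∀ {x} → x ∈ p → x ∉ q

∩≡⊥⇒Disjoint : {p q : Subset n} → p ∩ q ≡ ⊥ → Disjoint p q
∩≡⊥⇒Disjoint p∩q≡⊥ x∈p x∈q = ∉⊥ (subst (_ ∈_) p∩q≡⊥ (x∈p∩q⁺ (x∈p , x∈q)))

Disjoint-sym : {p q : Subset n} → Disjoint p q → Disjoint q p
Disjoint-sym p#q x∈q x∈p = p#q x∈p x∈q

Disjoint-∪ : {p q r : Subset n} → Disjoint p r → Disjoint q r → Disjoint (p ∪ q) r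
Disjoint-∪ {p = p} {q} p#r q#r x∈p∪q with x∈p∪q⁻ p q x∈p∪q
... | inj₁ x∈p = p#r x∈p
... | inj₂ x∈q = q#r x∈q

x∈p─q⁻ : ∀ {x : Fin n} (p q : Subset n) → x ∈ p ─ q → x ∈ p × x ∉ q
x∈p─q⁻ (s ∷ p) (outside ∷ q) here      = here , λ ()
x∈p─q⁻ (s ∷ p) (t ∷ q)       (there x) =
  let x∈p , x∉q = x∈p─q⁻ p q x in there x∈p , λ { (there x∈q) → x∉q x∈q }

x∈p─q⇒x∉q : ∀ {x : Fin n} {p q : Subset n} → x ∈ p ─ q → x ∉ q
x∈p─q⇒x∉q = proj₂ ∘ x∈p─q⁻ _ _

x∈p-y⇒x≢y : ∀ {x y : Fin n} {p : Subset n} → x ∈ p - y → x ≢ y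
x∈p-y⇒x≢y {y = y} x∈p-y refl = x∈p─q⇒x∉q x∈p-y (x∈⁅x⁆ y)

p⊆q∧p⊆r⇒p⊆q∩r : {p q r : Subset n} → p ⊆ q → p ⊆ r → p ⊆ q ∩ r
p⊆q∧p⊆r⇒p⊆q∩r p⊆q p⊆r x∈p = x∈p∩q⁺ (p⊆q x∈p , p⊆r x∈p)

p⊆r∧q⊆r⇒p∪q⊆r : {p q r : Subset n} → p ⊆ r → q ⊆ r → p ∪ q ⊆ r
p⊆r∧q⊆r⇒p∪q⊆r {p = p} {q} p⊆r q⊆r x∈p∪q with x∈p∪q⁻ p q x∈p∪q
... | inj₁ x∈p = p⊆r x∈p
... | inj₂ x∈q = q⊆r x∈q

p─q⊆r⇒p⊆q∪r : ∀ {p q r : Subset n} → p ─ q ⊆ r → p ⊆ q ∪ r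
p─q⊆r⇒p⊆q∪r {q = q} {r} p─q⊆r {x} x∈p with x ∈? q
... | yes x∈q = p⊆p∪q r x∈q
... | no  x∉q = q⊆p∪q q r (p─q⊆r (x∈p∧x∉q⇒x∈p─q x∈p x∉q))

p⊆q∪r⇒p⊆p∩q∪p∩r : {p q r : Subset n} → p ⊆ q ∪ r → p ⊆ (p ∩ q) ∪ (p ∩ r)
p⊆q∪r⇒p⊆p∩q∪p∩r {p = p} {q} {r} p⊆q∪r x∈p with x∈p∪q⁻ q r (p⊆q∪r x∈p)
... | inj₁ x∈q = p⊆p∪q (p ∩ r) (x∈p∩q⁺ (x∈p , x∈q))
... | inj₂ x∈r = q⊆p∪q (p ∩ q) (p ∩ r) (x∈p∩q⁺ (x∈p , x∈r))

p∪q─p≡q : ∀ {p q : Subset n} → Disjoint q p → (p ∪ q) ─ p ≡ q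
p∪q─p≡q {p = p} {q} q#p = ⊆-antisym ⊆q q⊆
  where
  ⊆q : (p ∪ q) ─ p ⊆ q
  ⊆q x∈ with x∈p─q⁻ (p ∪ q) p x∈
  ... | x∈p∪q , x∉p with x∈p∪q⁻ p q x∈p∪q
  ...   | inj₁ x∈p = ⊥-elim (x∉p x∈p)
  ...   | inj₂ x∈q = x∈q
  q⊆ : q ⊆ (p ∪ q) ─ p
  q⊆ x∈q = x∈p∧x∉q⇒x∈p─q (q⊆p∪q p q x∈q) (q#p x∈q)

p∪q─q≡p : ∀ {p q : Subset n} → Disjoint p q → (p ∪ q) ─ q ≡ p
p∪q─q≡p {p = p} {q} p#q = trans (cong (_─ q) (∪-comm p q)) (p∪q─p≡q p#q)

p─[p─q]≡q : ∀ {p q : Subset n} → q ⊆ p → p ─ (p ─ q) ≡ q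
p─[p─q]≡q {p = p} {q} q⊆p =
  ⊆-antisym ⊆q (λ x∈q → x∈p∧x∉q⇒x∈p─q (q⊆p x∈q) (λ x∈p─q → x∈p─q⇒x∉q x∈p─q x∈q))
  where
  ⊆q : p ─ (p ─ q) ⊆ q
  ⊆q {x} x∈ with x ∈? q
  ... | yes x∈q = x∈q
  ... | no  x∉q = let x∈p , x∉p─q = x∈p─q⁻ p (p ─ q) x∈ in ⊥-elim (x∉p─q (x∈p∧x∉q⇒x∈p─q x∈p x∉q))

p⊆X⇒p─[X─b]∩p≡b∩p : {X b p : Subset n} → p ⊆ X → p ─ ((X ─ b) ∩ p) ≡ b ∩ p
p⊆X⇒p─[X─b]∩p≡b∩p {X = X} {b} {p} p⊆X = ⊆-antisym ⊆b∩p b∩p⊆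
  where
  ⊆b∩p : p ─ ((X ─ b) ∩ p) ⊆ b ∩ p
  ⊆b∩p {x} x∈ with x∈p─q⁻ p _ x∈ | x ∈? b
  ... | x∈p , _      | yes x∈b = x∈p∩q⁺ (x∈b , x∈p)
  ... | x∈p , x∉X─b∩p | no x∉b = ⊥-elim (x∉X─b∩p (x∈p∩q⁺ (x∈p∧x∉q⇒x∈p─q (p⊆X x∈p) x∉b , x∈p)))
  b∩p⊆ : b ∩ p ⊆ p ─ ((X ─ b) ∩ p)
  b∩p⊆ x∈b∩p with x∈p∩q⁻ b p x∈b∩p
  ... | x∈b , x∈p = x∈p∧x∉q⇒x∈p─q x∈p λ x∈X─b∩p → x∈p─q⇒x∉q (p∩q⊆p _ p x∈X─b∩p) x∈b

p─q≡b∩p⇒q≡[X─b]∩p : {X b p q : Subset n} → p ⊆ X → q ⊆ p → p ─ q ≡ b ∩ p → q ≡ (X ─ b) ∩ p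
p─q≡b∩p⇒q≡[X─b]∩p {X = X} {b} {p} {q} p⊆X q⊆p p─q≡b∩p = ⊆-antisym q⊆ ⊆q
  where
  q⊆ : q ⊆ (X ─ b) ∩ p
  q⊆ {x} x∈q = x∈p∩q⁺ (x∈p∧x∉q⇒x∈p─q (p⊆X (q⊆p x∈q)) x∉b , q⊆p x∈q)
    where
    x∉b : x ∉ b
    x∉b x∈b = x∈p─q⇒x∉q (subst (_ ∈_) (sym p─q≡b∩p) (x∈p∩q⁺ (x∈b , q⊆p x∈q))) x∈q
  ⊆q : (X ─ b) ∩ p ⊆ q
  ⊆q {x} x∈ with x∈p∩q⁻ (X ─ b) p x∈ | x ∈? q
  ... | _ | yes x∈q = x∈q
  ... | x∈X─b , x∈p | no x∉q =
    ⊥-elim (x∈p─q⇒x∉q x∈X─b (p∩q⊆p b p (subst (_ ∈_) p─q≡b∩p (x∈p∧x∉q⇒x∈p─q x∈p x∉q))))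

[p∪q]∩r∩s≡p∩s : {p q r s : Subset n} → s ⊆ r → Disjoint q s → ((p ∪ q) ∩ r) ∩ s ≡ p ∩ s
[p∪q]∩r∩s≡p∩s {p = p} {q} {r} {s} s⊆r q#s = ⊆-antisym ⊆p∩s p∩s⊆
  where
  ⊆p∩s : ((p ∪ q) ∩ r) ∩ s ⊆ p ∩ s
  ⊆p∩s x∈ with x∈p∩q⁻ _ s x∈
  ... | x∈[p∪q]∩r , x∈s with x∈p∪q⁻ p q (p∩q⊆p _ r x∈[p∪q]∩r)
  ...   | inj₁ x∈p = x∈p∩q⁺ (x∈p , x∈s)
  ...   | inj₂ x∈q = ⊥-elim (q#s x∈q x∈s)
  p∩s⊆ : p ∩ s ⊆ ((p ∪ q) ∩ r) ∩ s
  p∩s⊆ x∈ = let x∈p , x∈s = x∈p∩q⁻ p s x∈ in x∈p∩q⁺ (x∈p∩q⁺ (p⊆p∪q q x∈p , s⊆r x∈s) , x∈s)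

x∈p⇒[p-x]∪⁅x⁆≡p : {x : Fin n} {p : Subset n} → x ∈ p → (p - x) ∪ ⁅ x ⁆ ≡ p
x∈p⇒[p-x]∪⁅x⁆≡p {x = x} {p} x∈p = ⊆-antisym ⊆p p⊆
  where
  ⊆p : (p - x) ∪ ⁅ x ⁆ ⊆ p
  ⊆p y∈ with x∈p∪q⁻ (p - x) ⁅ x ⁆ y∈
  ... | inj₁ y∈p-x = p─q⊆p p ⁅ x ⁆ y∈p-x
  ... | inj₂ y∈⁅x⁆ = subst (_∈ p) (sym (x∈⁅y⁆⇒x≡y x y∈⁅x⁆)) x∈p
  p⊆ : p ⊆ (p - x) ∪ ⁅ x ⁆
  p⊆ {y} y∈p with y ≟ x
  ... | yes refl = q⊆p∪q (p - x) ⁅ x ⁆ (x∈⁅x⁆ x)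
  ... | no  y≢x  = p⊆p∪q ⁅ x ⁆ (x∈p∧x≢y⇒x∈p-y y∈p y≢x)

Empty[p─q]⇒p⊆q : {p q : Subset n} → Empty (p ─ q) → p ⊆ q
Empty[p─q]⇒p⊆q {q = q} empty {x} x∈p with x ∈? q
... | yes x∈q = x∈q
... | no  x∉q = ⊥-elim (empty (x , x∈p∧x∉q⇒x∈p─q x∈p x∉q))

∣p∪q∣+∣p∩q∣≡∣p∣+∣q∣ : (p q : Subset n) → ∣ p ∪ q ∣ + ∣ p ∩ q ∣ ≡ ∣ p ∣ + ∣ q ∣
∣p∪q∣+∣p∩q∣≡∣p∣+∣q∣ []            []            = refl
∣p∪q∣+∣p∩q∣≡∣p∣+∣q∣ (outside ∷ p) (outside ∷ q) = ∣p∪q∣+∣p∩q∣≡∣p∣+∣q∣ p q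
∣p∪q∣+∣p∩q∣≡∣p∣+∣q∣ (inside ∷ p)  (outside ∷ q) = cong suc (∣p∪q∣+∣p∩q∣≡∣p∣+∣q∣ p q)
∣p∪q∣+∣p∩q∣≡∣p∣+∣q∣ (outside ∷ p) (inside ∷ q)  =
  trans (cong suc (∣p∪q∣+∣p∩q∣≡∣p∣+∣q∣ p q)) (sym (+-suc ∣ p ∣ ∣ q ∣))
∣p∪q∣+∣p∩q∣≡∣p∣+∣q∣ (inside ∷ p)  (inside ∷ q)  = cong suc (begin
  ∣ p ∪ q ∣ + suc ∣ p ∩ q ∣ ≡⟨ +-suc ∣ p ∪ q ∣ ∣ p ∩ q ∣ ⟩
  suc (∣ p ∪ q ∣ + ∣ p ∩ q ∣) ≡⟨ cong suc (∣p∪q∣+∣p∩q∣≡∣p∣+∣q∣ p q) ⟩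
  suc (∣ p ∣ + ∣ q ∣) ≡⟨ +-suc ∣ p ∣ ∣ q ∣ ⟨
  ∣ p ∣ + suc ∣ q ∣ ∎)
  where open ≡-Reasoning

∣p∪q∣≤∣p∣+∣q∣ : (p q : Subset n) → ∣ p ∪ q ∣ ≤ ∣ p ∣ + ∣ q ∣
∣p∪q∣≤∣p∣+∣q∣ p q = subst (∣ p ∪ q ∣ ≤_) (∣p∪q∣+∣p∩q∣≡∣p∣+∣q∣ p q) (m≤m+n ∣ p ∪ q ∣ ∣ p ∩ q ∣)

Disjoint⇒∣p∪q∣≡∣p∣+∣q∣ : {p q : Subset n} → Disjoint p q → ∣ p ∪ q ∣ ≡ ∣ p ∣ + ∣ q ∣
Disjoint⇒∣p∪q∣≡∣p∣+∣q∣ {n} {p} {q} p#q = begin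
  ∣ p ∪ q ∣ ≡⟨ +-identityʳ ∣ p ∪ q ∣ ⟨
  ∣ p ∪ q ∣ + 0 ≡⟨ cong (∣ p ∪ q ∣ +_) (∣⊥∣≡0 n) ⟨
  ∣ p ∪ q ∣ + ∣ ⊥ {n} ∣ ≡⟨ cong (λ r → ∣ p ∪ q ∣ + ∣ r ∣) p∩q≡⊥ ⟨
  ∣ p ∪ q ∣ + ∣ p ∩ q ∣ ≡⟨ ∣p∪q∣+∣p∩q∣≡∣p∣+∣q∣ p q ⟩
  ∣ p ∣ + ∣ q ∣ ∎
  where
  open ≡-Reasoning
  p∩q≡⊥ : p ∩ q ≡ ⊥
  p∩q≡⊥ = Empty-unique λ (x , x∈p∩q) → let x∈p , x∈q = x∈p∩q⁻ p q x∈p∩q in p#q x∈p x∈q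

p⊆q∧∣q∣≤∣p∣⇒q⊆p : {p q : Subset n} → p ⊆ q → ∣ q ∣ ≤ ∣ p ∣ → q ⊆ p
p⊆q∧∣q∣≤∣p∣⇒q⊆p {p = p} p⊆q ∣q∣≤∣p∣ {x} x∈q with x ∈? p
... | yes x∈p = x∈p
... | no  x∉p = ⊥-elim (<⇒≱ (p⊂q⇒∣p∣<∣q∣ (p⊆q , x , x∈q , x∉p)) ∣q∣≤∣p∣)

∣[p-x]∪⁅y⁆∣≡∣p∣ : {x y : Fin n} {p : Subset n} → x ∈ p → y ∉ p → ∣ (p - x) ∪ ⁅ y ⁆ ∣ ≡ ∣ p ∣
∣[p-x]∪⁅y⁆∣≡∣p∣ {x = x} {y} {p} x∈p y∉p = begin
  ∣ (p - x) ∪ ⁅ y ⁆ ∣   ≡⟨ Disjoint⇒∣p∪q∣≡∣p∣+∣q∣ y∉p-x ⟩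
  ∣ p - x ∣ + ∣ ⁅ y ⁆ ∣ ≡⟨ cong (∣ p - x ∣ +_) (trans (∣⁅x⁆∣≡1 y) (sym (∣⁅x⁆∣≡1 x))) ⟩
  ∣ p - x ∣ + ∣ ⁅ x ⁆ ∣ ≡⟨ Disjoint⇒∣p∪q∣≡∣p∣+∣q∣ x∉p-x ⟨
  ∣ (p - x) ∪ ⁅ x ⁆ ∣   ≡⟨ cong ∣_∣ (x∈p⇒[p-x]∪⁅x⁆≡p x∈p) ⟩
  ∣ p ∣                 ∎
  where
  open ≡-Reasoning
  y∉p-x : Disjoint (p - x) ⁅ y ⁆
  y∉p-x z∈p-x z∈⁅y⁆ = y∉p (subst (_∈ p) (x∈⁅y⁆⇒x≡y y z∈⁅y⁆) (p─q⊆p p ⁅ x ⁆ z∈p-x))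
  x∉p-x : Disjoint (p - x) ⁅ x ⁆
  x∉p-x z∈p-x z∈⁅x⁆ = x∈p-y⇒x≢y z∈p-x (x∈⁅y⁆⇒x≡y x z∈⁅x⁆)

∣[p-x]∪⁅y⁆─r∣<∣p─r∣ : {x y : Fin n} {p r : Subset n} → x ∈ p → x ∉ r → y ∈ r →
                      ∣ ((p - x) ∪ ⁅ y ⁆) ─ r ∣ < ∣ p ─ r ∣
∣[p-x]∪⁅y⁆─r∣<∣p─r∣ {x = x} {y} {p} {r} x∈p x∉r y∈r =
  p⊂q⇒∣p∣<∣q∣ (⊆p─r , x , x∈p∧x∉q⇒x∈p─q x∈p x∉r , x∉)
  where
  ⊆p─r : ((p - x) ∪ ⁅ y ⁆) ─ r ⊆ p ─ r
  ⊆p─r z∈ with x∈p─q⁻ _ r z∈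
  ... | z∈∪ , z∉r with x∈p∪q⁻ (p - x) ⁅ y ⁆ z∈∪
  ...   | inj₁ z∈p-x = x∈p∧x∉q⇒x∈p─q (p─q⊆p p ⁅ x ⁆ z∈p-x) z∉r
  ...   | inj₂ z∈⁅y⁆ = ⊥-elim (z∉r (subst (_∈ r) (sym (x∈⁅y⁆⇒x≡y y z∈⁅y⁆)) y∈r))
  x∉ : x ∉ ((p - x) ∪ ⁅ y ⁆) ─ r
  x∉ x∈ with x∈p─q⁻ _ r x∈
  ... | x∈∪ , _ with x∈p∪q⁻ (p - x) ⁅ y ⁆ x∈∪
  ...   | inj₁ x∈p-x = x∈p-y⇒x≢y x∈p-x refl
  ...   | inj₂ x∈⁅y⁆ = x∉r (subst (_∈ r) (sym (x∈⁅y⁆⇒x≡y y x∈⁅y⁆)) y∈r)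

≐-sym : {F G : Family n} → F ≐ G → G ≐ F
≐-sym F≐G c = proj₂ (F≐G c) , proj₁ (F≐G c)

≐-trans : {F G H : Family n} → F ≐ G → G ≐ H → F ≐ H
≐-trans F≐G G≐H c = proj₁ (G≐H c) ∘ proj₁ (F≐G c) , proj₂ (F≐G c) ∘ proj₂ (G≐H c)

Maximal-≐ : {F G : Family n} → F ≐ G → Maximal F ≐ Maximal G
Maximal-≐ F≐G c = to F≐G , to (≐-sym F≐G)
  where
  to : ∀ {F G} → F ≐ G → Maximal F c → Maximal G c
  to F≐G (Fc , max) = proj₁ (F≐G c) Fc , λ d Gd c⊆d → max d (proj₂ (F≐G d) Gd) c⊆d

Maximal-⊇ : {F : Family n} {m i : Subset n} → Maximal F m → F i → m ⊆ i → Maximal F i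
Maximal-⊇ (_ , max) Fi m⊆i = Fi , λ d Fd i⊆d → ⊆-trans (max d Fd (⊆-trans m⊆i i⊆d)) m⊆i

Maximal-transfer : {F G : Family n} {m : Subset n} →
                   Maximal F m → G m → (∀ {d} → G d → F d) → Maximal G m
Maximal-transfer (_ , max) Gm G⇒F = Gm , λ d Gd m⊆d → max d (G⇒F Gd) m⊆d

-- F need not be decidable, so a maximal extension exists only up to double negation;
-- this suffices for the decidable conclusions (inclusions) it is used for.
¬¬-Maximal-⊇ : (F : Family n) {d : Subset n} → F d → ¬ ¬ (∃ λ m → Maximal F m × d ⊆ m)
¬¬-Maximal-⊇ {n} F {d} = go n (m≤m+n n ∣ d ∣)
  where
  go : ∀ k {d} → n ≤ k + ∣ d ∣ → F d → ¬ ¬ (∃ λ m → Maximal F m × d ⊆ m)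
  go k {d} n≤k+∣d∣ Fd noMax = ¬¬-excluded-middle λ
    { (no none) → noMax (d , (Fd , λ d' Fd' d⊆d' → d'⊆d none d' Fd' d⊆d') , ⊆-refl)
    ; (yes (d' , Fd' , d⊂d')) → larger k n≤k+∣d∣ Fd' d⊂d' }
    where
    d'⊆d : ¬ (∃ λ d' → F d' × d ⊂ d') → ∀ d' → F d' → d ⊆ d' → d' ⊆ d
    d'⊆d none d' Fd' d⊆d' {x} x∈d' with x ∈? d
    ... | yes x∈d = x∈d
    ... | no  x∉d = ⊥-elim (none (d' , Fd' , d⊆d' , x , x∈d' , x∉d))
    larger : ∀ k {d'} → n ≤ k + ∣ d ∣ → F d' → ¬ d ⊂ d'
    larger zero    {d'} n≤∣d∣ _ d⊂d' = <⇒≱ (<-≤-trans (p⊂q⇒∣p∣<∣q∣ d⊂d') (∣p∣≤n d')) n≤∣d∣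
    larger (suc k) {d'} n≤k+∣d∣ Fd' d⊂d' =
      go k (≤-trans n≤k+∣d∣ (≤-trans (≤-reflexive (sym (+-suc k ∣ d ∣))) (+-monoʳ-≤ k ∣d∣<∣d'∣))) Fd'
        (λ (m , maxm , d'⊆m) → noMax (m , maxm , ⊆-trans (proj₁ d⊂d') d'⊆m))
      where
      ∣d∣<∣d'∣ : ∣ d ∣ < ∣ d' ∣
      ∣d∣<∣d'∣ = p⊂q⇒∣p∣<∣q∣ d⊂d'

IndepIn : Family n → Subset n → Family n
IndepIn B Y i = Indep B i × i ⊆ Y

Indep-⊆ : {B : Family n} {i j : Subset n} → Indep B i → j ⊆ i → Indep B j
Indep-⊆ (b , Bb , i⊆b) j⊆i = b , Bb , ⊆-trans j⊆i i⊆b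

base∩-IndepIn : {B : Family n} {b : Subset n} (Y : Subset n) → B b → IndepIn B Y (b ∩ Y)
base∩-IndepIn {b = b} Y Bb = (b , Bb , p∩q⊆p b Y) , p∩q⊆q b Y

Indep-≐ : {F G : Family n} → F ≐ G → Indep F ≐ Indep G
Indep-≐ F≐G i = to F≐G , to (≐-sym F≐G)
  where
  to : ∀ {F G} → F ≐ G → Indep F i → Indep G i
  to F≐G (b , Fb , i⊆b) = b , proj₁ (F≐G b) Fb , i⊆b

restrict-≐ : {F G : Family n} (T : Subset n) → F ≐ G → restrict F T ≐ restrict G T
restrict-≐ T F≐G = Maximal-≐ λ i → (λ (Ii , i⊆T) → proj₁ (Indep-≐ F≐G i) Ii , i⊆T)
                                , (λ (Ii , i⊆T) → proj₂ (Indep-≐ F≐G i) Ii , i⊆T)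

contract-≐ : {F G : Family n} (X T : Subset n) → F ≐ G → contract X F T ≐ contract X G T
contract-≐ X T F≐G c = to F≐G , to (≐-sym F≐G)
  where
  to : ∀ {F G} → F ≐ G → contract X F T c → contract X G T c
  to F≐G (b , Fb , base , c≡) = b , proj₁ (F≐G b) Fb , proj₁ (restrict-≐ (X ─ T) F≐G _) base , c≡

restrict⊆ : {F : Family n} {T c : Subset n} → restrict F T c → c ⊆ T
restrict⊆ ((_ , c⊆T) , _) = c⊆T

contract⊆ : {X : Subset n} {F : Family n} {T c : Subset n} → contract X F T c → c ⊆ T
contract⊆ (b , _ , _ , refl) = p∩q⊆q b _

subst-restrict∩ : {F : Family n} {b W W′ : Subset n} →
                  W ≡ W′ → restrict F W (b ∩ W) → restrict F W′ (b ∩ W′)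
subst-restrict∩ refl maxW = maxW

-- Matroids and duality

module Matroid {X : Subset n} {B : Family n} (isM : IsMatroid X B) where
  open IsMatroid isM

  base-⊆⇒⊇ : ∀ {b₁ b₂} → B b₁ → B b₂ → b₁ ⊆ b₂ → b₂ ⊆ b₁
  base-⊆⇒⊇ {b₁} B₁ B₂ b₁⊆b₂ {x} x∈b₂ with x ∈? b₁
  ... | yes x∈b₁ = x∈b₁
  ... | no  x∉b₁ = let _ , y∈b₁ , y∉b₂ , _ = exchange B₂ B₁ x∈b₂ x∉b₁ in ⊥-elim (y∉b₂ (b₁⊆b₂ y∈b₁))

  -- Exchanging towards b₂ keeps the size and shrinks the difference with b₂.
  ∣base∣≡∣base∣ : ∀ {b₁ b₂} → B b₁ → B b₂ → ∣ b₁ ∣ ≡ ∣ b₂ ∣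
  ∣base∣≡∣base∣ {b₁} {b₂} = go (suc ∣ b₁ ─ b₂ ∣) ≤-refl
    where
    go : ∀ k {b₁} → ∣ b₁ ─ b₂ ∣ < k → B b₁ → B b₂ → ∣ b₁ ∣ ≡ ∣ b₂ ∣
    go (suc k) {b₁} bound B₁ B₂ with nonempty? (b₁ ─ b₂)
    ... | no empty = cong ∣_∣ (⊆-antisym b₁⊆b₂ (base-⊆⇒⊇ B₁ B₂ b₁⊆b₂))
      where
      b₁⊆b₂ : b₁ ⊆ b₂
      b₁⊆b₂ = Empty[p─q]⇒p⊆q empty
    ... | yes (x , x∈b₁─b₂) with x∈p─q⁻ b₁ b₂ x∈b₁─b₂
    ...   | x∈b₁ , x∉b₂ with exchange B₁ B₂ x∈b₁ x∉b₂
    ...     | y , y∈b₂ , y∉b₁ , B₁′ =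
      trans (sym (∣[p-x]∪⁅y⁆∣≡∣p∣ x∈b₁ y∉b₁))
            (go k (<-≤-trans (∣[p-x]∪⁅y⁆─r∣<∣p─r∣ x∈b₁ x∉b₂ y∈b₂) (≤-pred bound)) B₁′ B₂)

  Indep-extend : ∀ {i b} → Indep B i → B b → ∃ λ b′ → B b′ × i ⊆ b′ × b′ ⊆ i ∪ b
  Indep-extend {i} {b} (b₀ , B₀ , i⊆b₀) Bb = go (suc ∣ b₀ ─ (i ∪ b) ∣) ≤-refl B₀ i⊆b₀
    where
    go : ∀ k {b₀} → ∣ b₀ ─ (i ∪ b) ∣ < k → B b₀ → i ⊆ b₀ → ∃ λ b′ → B b′ × i ⊆ b′ × b′ ⊆ i ∪ b
    go (suc k) {b₀} bound B₀ i⊆b₀ with nonempty? (b₀ ─ (i ∪ b))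
    ... | no empty = b₀ , B₀ , i⊆b₀ , Empty[p─q]⇒p⊆q empty
    ... | yes (x , x∈b₀─i∪b) with x∈p─q⁻ b₀ (i ∪ b) x∈b₀─i∪b
    ...   | x∈b₀ , x∉i∪b with exchange B₀ Bb x∈b₀ (x∉i∪b ∘ q⊆p∪q i b)
    ...     | y , y∈b , _ , B₀′ =
      go k (<-≤-trans (∣[p-x]∪⁅y⁆─r∣<∣p─r∣ x∈b₀ x∉i∪b (q⊆p∪q i b y∈b)) (≤-pred bound)) B₀′ i⊆b₀′
      where
      i⊆b₀′ : i ⊆ (b₀ - x) ∪ ⁅ y ⁆
      i⊆b₀′ z∈i = p⊆p∪q ⁅ y ⁆ (x∈p∧x≢y⇒x∈p-y (i⊆b₀ z∈i) λ { refl → x∉i∪b (p⊆p∪q b z∈i) })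

  restrict⇒base∩ : ∀ {Y m} → restrict B Y m → ∃ λ b → B b × m ⊆ b × b ∩ Y ⊆ m
  restrict⇒base∩ {Y} (((b , Bb , m⊆b) , m⊆Y) , max) =
    b , Bb , m⊆b , max (b ∩ Y) (base∩-IndepIn Y Bb) (p⊆q∧p⊆r⇒p⊆q∩r m⊆b m⊆Y)

  ∣IndepIn∣≤∣restrict∣ : ∀ {Y i m} → IndepIn B Y i → restrict B Y m → ∣ i ∣ ≤ ∣ m ∣
  ∣IndepIn∣≤∣restrict∣ {Y} {i} {m} ((b₁ , B₁ , i⊆b₁) , i⊆Y) ((Im , m⊆Y) , max)
    with Indep-extend Im B₁
  ... | b , Bb , m⊆b , b⊆m∪b₁ = +-cancelʳ-≤ (∣ b₁ ─ Y ∣) (∣ i ∣) (∣ m ∣) (begin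
    ∣ i ∣ + ∣ b₁ ─ Y ∣  ≡⟨ Disjoint⇒∣p∪q∣≡∣p∣+∣q∣ (λ x∈i x∈b₁─Y → x∈p─q⇒x∉q x∈b₁─Y (i⊆Y x∈i)) ⟨
    ∣ i ∪ (b₁ ─ Y) ∣    ≤⟨ p⊆q⇒∣p∣≤∣q∣ (p⊆r∧q⊆r⇒p∪q⊆r i⊆b₁ (p─q⊆p b₁ Y)) ⟩
    ∣ b₁ ∣              ≡⟨ ∣base∣≡∣base∣ B₁ Bb ⟩
    ∣ b ∣               ≤⟨ p⊆q⇒∣p∣≤∣q∣ b⊆m∪[b₁─Y] ⟩
    ∣ m ∪ (b₁ ─ Y) ∣    ≤⟨ ∣p∪q∣≤∣p∣+∣q∣ m (b₁ ─ Y) ⟩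
    ∣ m ∣ + ∣ b₁ ─ Y ∣  ∎)
    where
    open ≤-Reasoning
    b∩Y⊆m : b ∩ Y ⊆ m
    b∩Y⊆m = max (b ∩ Y) (base∩-IndepIn Y Bb) (p⊆q∧p⊆r⇒p⊆q∩r m⊆b m⊆Y)
    b⊆m∪[b₁─Y] : b ⊆ m ∪ (b₁ ─ Y)
    b⊆m∪[b₁─Y] {x} x∈b with x∈p∪q⁻ m b₁ (b⊆m∪b₁ x∈b) | x ∈? Y
    ... | inj₁ x∈m  | _       = p⊆p∪q (b₁ ─ Y) x∈m
    ... | inj₂ _    | yes x∈Y = p⊆p∪q (b₁ ─ Y) (b∩Y⊆m (x∈p∩q⁺ (x∈b , x∈Y)))
    ... | inj₂ x∈b₁ | no  x∉Y = q⊆p∪q m (b₁ ─ Y) (x∈p∧x∉q⇒x∈p─q x∈b₁ x∉Y)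

  -- b ∩ Y is as large as an independent subset of Y can be, so the rest of b is as small as possible.
  ∣b∩[X─Y]∣≤∣b′∩[X─Y]∣ : ∀ {Y b b′} → B b → B b′ → restrict B Y (b ∩ Y) →
                          ∣ b ∩ (X ─ Y) ∣ ≤ ∣ b′ ∩ (X ─ Y) ∣
  ∣b∩[X─Y]∣≤∣b′∩[X─Y]∣ {Y} {b} {b′} Bb Bb′ maxY = +-cancelˡ-≤ (∣ b ∩ Y ∣) (∣ b ∩ Z ∣) (∣ b′ ∩ Z ∣) (begin
    ∣ b ∩ Y ∣ + ∣ b ∩ Z ∣   ≡⟨ Disjoint⇒∣p∪q∣≡∣p∣+∣q∣ b∩Y#b∩Z ⟨
    ∣ (b ∩ Y) ∪ (b ∩ Z) ∣   ≤⟨ p⊆q⇒∣p∣≤∣q∣ (p⊆r∧q⊆r⇒p∪q⊆r (p∩q⊆p b Y) (p∩q⊆p b Z)) ⟩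
    ∣ b ∣                   ≡⟨ ∣base∣≡∣base∣ Bb Bb′ ⟩
    ∣ b′ ∣                  ≤⟨ p⊆q⇒∣p∣≤∣q∣ (p⊆q∪r⇒p⊆p∩q∪p∩r (⊆-trans (base⊆ground Bb′) X⊆Y∪Z)) ⟩
    ∣ (b′ ∩ Y) ∪ (b′ ∩ Z) ∣ ≤⟨ ∣p∪q∣≤∣p∣+∣q∣ (b′ ∩ Y) (b′ ∩ Z) ⟩
    ∣ b′ ∩ Y ∣ + ∣ b′ ∩ Z ∣ ≤⟨ +-monoˡ-≤ (∣ b′ ∩ Z ∣) (∣IndepIn∣≤∣restrict∣ (base∩-IndepIn Y Bb′) maxY) ⟩
    ∣ b ∩ Y ∣ + ∣ b′ ∩ Z ∣  ∎)
    where
    open ≤-Reasoning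
    Z : Subset n
    Z = X ─ Y
    X⊆Y∪Z : X ⊆ Y ∪ Z
    X⊆Y∪Z = p─q⊆r⇒p⊆q∪r ⊆-refl
    b∩Y#b∩Z : Disjoint (b ∩ Y) (b ∩ Z)
    b∩Y#b∩Z x∈b∩Y x∈b∩Z = x∈p─q⇒x∉q (p∩q⊆q b Z x∈b∩Z) (p∩q⊆q b Y x∈b∩Y)

  restrict⇒dual-restrict : ∀ {Y b} → B b → restrict B Y (b ∩ Y) →
                           restrict (dual X B) (X ─ Y) ((X ─ b) ∩ (X ─ Y))
  restrict⇒dual-restrict {Y} {b} Bb maxY = base∩-IndepIn Z (b , Bb , refl) , max
    where
    Z : Subset n
    Z = X ─ Y
    max : ∀ d → IndepIn (dual X B) Z d → (X ─ b) ∩ Z ⊆ d → d ⊆ (X ─ b) ∩ Z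
    max d ((_ , (b′ , Bb′ , refl) , d⊆X─b′) , d⊆Z) X─b∩Z⊆d {x} x∈d =
      x∈p∩q⁺ (x∈p∧x∉q⇒x∈p─q (p─q⊆p X Y (d⊆Z x∈d)) x∉b , d⊆Z x∈d)
      where
      b′∩Z⊆b∩Z : b′ ∩ Z ⊆ b ∩ Z
      b′∩Z⊆b∩Z {y} y∈b′∩Z with x∈p∩q⁻ b′ Z y∈b′∩Z | y ∈? b
      ... | _    , y∈Z | yes y∈b = x∈p∩q⁺ (y∈b , y∈Z)
      ... | y∈b′ , y∈Z | no  y∉b = ⊥-elim (x∈p─q⇒x∉q (d⊆X─b′ y∈d) y∈b′)
        where
        y∈d : y ∈ d
        y∈d = X─b∩Z⊆d (x∈p∩q⁺ (x∈p∧x∉q⇒x∈p─q (p─q⊆p X Y y∈Z) y∉b , y∈Z))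
      b∩Z⊆b′ : b ∩ Z ⊆ b′
      b∩Z⊆b′ y∈b∩Z = p∩q⊆p b′ Z (p⊆q∧∣q∣≤∣p∣⇒q⊆p b′∩Z⊆b∩Z (∣b∩[X─Y]∣≤∣b′∩[X─Y]∣ Bb Bb′ maxY) y∈b∩Z)
      x∉b : x ∉ b
      x∉b x∈b = x∈p─q⇒x∉q (d⊆X─b′ x∈d) (b∩Z⊆b′ (x∈p∩q⁺ (x∈b , d⊆Z x∈d)))

  dual-restrict⇒restrict : ∀ {Y b} → B b → restrict (dual X B) (X ─ Y) ((X ─ b) ∩ (X ─ Y)) →
                           restrict B Y (b ∩ Y)
  dual-restrict⇒restrict {Y} {b} Bb maxZ = base∩-IndepIn Y Bb , max
    where
    Z : Subset n
    Z = X ─ Y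
    max : ∀ d → IndepIn B Y d → b ∩ Y ⊆ d → d ⊆ b ∩ Y
    max d (Id , d⊆Y) b∩Y⊆d with Indep-extend Id Bb
    ... | b′ , Bb′ , d⊆b′ , b′⊆d∪b = λ x∈d → x∈p∩q⁺ (b′⊆b (d⊆b′ x∈d) , d⊆Y x∈d)
      where
      X─b∩Z⊆X─b′∩Z : (X ─ b) ∩ Z ⊆ (X ─ b′) ∩ Z
      X─b∩Z⊆X─b′∩Z {x} x∈ with x∈p∩q⁻ (X ─ b) Z x∈
      ... | x∈X─b , x∈Z = x∈p∩q⁺ (x∈p∧x∉q⇒x∈p─q (p─q⊆p X b x∈X─b) x∉b′ , x∈Z)
        where
        x∉b′ : x ∉ b′
        x∉b′ x∈b′ with x∈p∪q⁻ d b (b′⊆d∪b x∈b′)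
        ... | inj₁ x∈d = x∈p─q⇒x∉q x∈Z (d⊆Y x∈d)
        ... | inj₂ x∈b = x∈p─q⇒x∉q x∈X─b x∈b
      X─b′∩Z⊆X─b∩Z : (X ─ b′) ∩ Z ⊆ (X ─ b) ∩ Z
      X─b′∩Z⊆X─b∩Z = proj₂ maxZ _ (base∩-IndepIn Z (b′ , Bb′ , refl)) X─b∩Z⊆X─b′∩Z
      b⊆b′ : b ⊆ b′
      b⊆b′ {x} x∈b with x ∈? Y | x ∈? b′
      ... | yes x∈Y | _        = d⊆b′ (b∩Y⊆d (x∈p∩q⁺ (x∈b , x∈Y)))
      ... | no  _   | yes x∈b′ = x∈b′
      ... | no  x∉Y | no  x∉b′ = ⊥-elim (x∈p─q⇒x∉q (p∩q⊆p _ Z (X─b′∩Z⊆X─b∩Z x∈X─b′∩Z)) x∈b)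
        where
        x∈X : x ∈ X
        x∈X = base⊆ground Bb x∈b
        x∈X─b′∩Z : x ∈ (X ─ b′) ∩ Z
        x∈X─b′∩Z = x∈p∩q⁺ (x∈p∧x∉q⇒x∈p─q x∈X x∉b′ , x∈p∧x∉q⇒x∈p─q x∈X x∉Y)
      b′⊆b : b′ ⊆ b
      b′⊆b = base-⊆⇒⊇ Bb Bb′ b⊆b′

  module _ {T : Subset n} (T⊆X : T ⊆ X) where

    private
      X─[X─T]≡T : X ─ (X ─ T) ≡ T
      X─[X─T]≡T = p─[p─q]≡q T⊆X

    contract⇒dual-restrict : ∀ {c} → c ⊆ T → contract X B T (T ─ c) → restrict (dual X B) T c
    contract⇒dual-restrict {c} c⊆T (b , Bb , maxX─T , T─c≡b∩T) =
      subst (restrict (dual X B) T) (sym (p─q≡b∩p⇒q≡[X─b]∩p T⊆X c⊆T T─c≡b∩T))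
        (subst-restrict∩ X─[X─T]≡T (restrict⇒dual-restrict Bb maxX─T))

    dual-restrict⇒contract : ∀ {c} → restrict (dual X B) T c → contract X B T (T ─ c)
    dual-restrict⇒contract {c} maxc@(((_ , (b , Bb , refl) , c⊆X─b) , c⊆T) , max) =
      b , Bb , dual-restrict⇒restrict Bb maxX─[X─T] , trans (cong (T ─_) c≡) (p⊆X⇒p─[X─b]∩p≡b∩p T⊆X)
      where
      c⊆X─b∩T : c ⊆ (X ─ b) ∩ T
      c⊆X─b∩T = p⊆q∧p⊆r⇒p⊆q∩r c⊆X─b c⊆T
      c≡ : c ≡ (X ─ b) ∩ T
      c≡ = ⊆-antisym c⊆X─b∩T (max _ (base∩-IndepIn T (b , Bb , refl)) c⊆X─b∩T)
      maxX─[X─T] : restrict (dual X B) (X ─ (X ─ T)) ((X ─ b) ∩ (X ─ (X ─ T)))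
      maxX─[X─T] = subst-restrict∩ (sym X─[X─T]≡T) (subst (restrict (dual X B) T) c≡ maxc)

    dual-contract⇒restrict : ∀ {c} → contract X (dual X B) T c → restrict B T (T ─ c)
    dual-contract⇒restrict (_ , (b , Bb , refl) , maxX─T , refl) =
      subst (restrict B T) (sym (p⊆X⇒p─[X─b]∩p≡b∩p T⊆X)) (dual-restrict⇒restrict Bb maxX─T)

    restrict⇒dual-contract : ∀ {c} → c ⊆ T → restrict B T (T ─ c) → contract X (dual X B) T c
    restrict⇒dual-contract {c} c⊆T maxT─c with restrict⇒base∩ maxT─c
    ... | b , Bb , T─c⊆b , b∩T⊆T─c =
      X ─ b , (b , Bb , refl) , restrict⇒dual-restrict Bb (subst (restrict B T) T─c≡b∩T maxT─c) ,
      p─q≡b∩p⇒q≡[X─b]∩p T⊆X c⊆T T─c≡b∩T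
      where
      T─c≡b∩T : T ─ c ≡ b ∩ T
      T─c≡b∩T = ⊆-antisym (p⊆q∧p⊆r⇒p⊆q∩r T─c⊆b (p─q⊆p T c)) b∩T⊆T─c

-- Matroid union and linking

Unions : Family n → Family n → Family n
Unions B₁ B₂ c = ∃ λ b₁ → ∃ λ b₂ → B₁ b₁ × B₂ b₂ × c ≡ b₁ ∪ b₂

Unions-≐ : {F F′ G G′ : Family n} → F ≐ F′ → G ≐ G′ → Unions F G ≐ Unions F′ G′
Unions-≐ F≐F′ G≐G′ c = to F≐F′ G≐G′ , to (≐-sym F≐F′) (≐-sym G≐G′)
  where
  to : ∀ {F F′ G G′} → F ≐ F′ → G ≐ G′ → Unions F G c → Unions F′ G′ c
  to F≐F′ G≐G′ (b₁ , b₂ , Fb₁ , Gb₂ , c≡) = b₁ , b₂ , proj₁ (F≐F′ b₁) Fb₁ , proj₁ (G≐G′ b₂) Gb₂ , c≡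

Unions-comm : (F G : Family n) → Unions F G ≐ Unions G F
Unions-comm F G c = swap , swap
  where
  swap : ∀ {F G} → Unions F G c → Unions G F c
  swap (b₁ , b₂ , Fb₁ , Gb₂ , c≡) = b₂ , b₁ , Gb₂ , Fb₁ , trans c≡ (∪-comm b₁ b₂)

dsum-zeroM : (F : Family n) → dsum F zeroM ≐ F
dsum-zeroM F c = (λ { (b , _ , Fb , refl , refl) → subst F (sym (∪-identityʳ b)) Fb })
               , λ Fc → c , ⊥ , Fc , refl , sym (∪-identityʳ c)

link≐contract-union : (S P Q : Subset n) (A B : Family n) →
                      link S P Q A B ≐ contract (S ∪ P ∪ Q) (union A B) (S ∪ Q)
link≐contract-union S P Q A B =
  contract-≐ (S ∪ P ∪ Q) (S ∪ Q) (Maximal-≐ (Unions-≐ (dsum-zeroM A) (dsum-zeroM B)))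

link-comm : (S P Q : Subset n) (A B : Family n) → link Q P S B A ≐ link S P Q A B
link-comm {n} S P Q A B =
  subst₂ (λ X T → contract X U′ T ≐ link S P Q A B) S∪P∪Q≡Q∪P∪S (∪-comm S Q)
    (contract-≐ (S ∪ P ∪ Q) (S ∪ Q) (Maximal-≐ (Unions-comm (dsum B zeroM) (dsum A zeroM))))
  where
  U′ : Family n
  U′ = union (dsum B zeroM) (dsum A zeroM)
  S∪P∪Q≡Q∪P∪S : S ∪ P ∪ Q ≡ Q ∪ P ∪ S
  S∪P∪Q≡Q∪P∪S = trans (cong (S ∪_) (∪-comm P Q)) (trans (∪-comm S (Q ∪ P)) (∪-assoc Q P S))

-- The union matroid has rank r(A) + r(B), which disjoint bases attain.
Disjoint-bases⇒union : {X Y : Subset n} {A B : Family n} → IsMatroid X A → IsMatroid Y B →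
                       ∀ {a b} → A a → B b → Disjoint a b → union A B (a ∪ b)
Disjoint-bases⇒union {A = A} {B} isA isB {a} {b} Aa Bb a#b = (a , b , Aa , Bb , refl) , max
  where
  open ≤-Reasoning
  max : ∀ d → Unions A B d → a ∪ b ⊆ d → d ⊆ a ∪ b
  max _ (a′ , b′ , Aa′ , Bb′ , refl) a∪b⊆a′∪b′ = p⊆q∧∣q∣≤∣p∣⇒q⊆p a∪b⊆a′∪b′ (begin
    ∣ a′ ∪ b′ ∣     ≤⟨ ∣p∪q∣≤∣p∣+∣q∣ a′ b′ ⟩
    ∣ a′ ∣ + ∣ b′ ∣ ≡⟨ cong₂ _+_ (Matroid.∣base∣≡∣base∣ isA Aa′ Aa) (Matroid.∣base∣≡∣base∣ isB Bb′ Bb) ⟩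
    ∣ a ∣ + ∣ b ∣   ≡⟨ Disjoint⇒∣p∪q∣≡∣p∣+∣q∣ a#b ⟨
    ∣ a ∪ b ∣       ∎)

module Linking {S P Q : Subset n} {A B : Family n}
  (S#P : Disjoint S P) (P#Q : Disjoint P Q) (S#Q : Disjoint S Q)
  (isA : IsMatroid (S ∪ P) A) (isB : IsMatroid (P ∪ Q) B)
  (A∘P≐B*∘P : restrict A P ≐ restrict (dual (P ∪ Q) B) P)
  (A×P≐B*×P : contract (S ∪ P) A P ≐ contract (P ∪ Q) (dual (P ∪ Q) B) P)
  where

  private
    module MA = Matroid isA
    module MB = Matroid isB

    S∪P─S≡P : (S ∪ P) ─ S ≡ P
    S∪P─S≡P = p∪q─p≡q (Disjoint-sym S#P)

    S∪P─P≡S : (S ∪ P) ─ P ≡ S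
    S∪P─P≡S = p∪q─q≡p S#P

    S∪Q─S≡Q : (S ∪ Q) ─ S ≡ Q
    S∪Q─S≡Q = p∪q─p≡q (Disjoint-sym S#Q)

    P∪Q─P≡Q : (P ∪ Q) ─ P ≡ Q
    P∪Q─P≡Q = p∪q─p≡q (Disjoint-sym P#Q)

    P∪Q#S : Disjoint (P ∪ Q) S
    P∪Q#S = Disjoint-∪ (Disjoint-sym S#P) (Disjoint-sym S#Q)

    S∪P∪Q─[S∪Q]≡P : (S ∪ P ∪ Q) ─ (S ∪ Q) ≡ P
    S∪P∪Q─[S∪Q]≡P = trans (sym (p─q─r≡p─q∪r (S ∪ P ∪ Q) S Q))
                          (trans (cong (_─ Q) (p∪q─p≡q P∪Q#S)) (p∪q─q≡p P#Q))

    b#S : ∀ {b} → B b → Disjoint b S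
    b#S Bb x∈b = P∪Q#S (IsMatroid.base⊆ground isB Bb x∈b)

    a#Q : ∀ {a} → A a → Disjoint a Q
    a#Q Aa x∈a = Disjoint-∪ S#Q P#Q (IsMatroid.base⊆ground isA Aa x∈a)

  A×P⇒B∘P : ∀ {c} → contract (S ∪ P) A P c → restrict B P (P ─ c)
  A×P⇒B∘P A×Pc = MB.dual-contract⇒restrict (p⊆p∪q Q) (proj₁ (A×P≐B*×P _) A×Pc)

  B∘P⇒A×P : ∀ {c} → c ⊆ P → restrict B P (P ─ c) → contract (S ∪ P) A P c
  B∘P⇒A×P c⊆P B∘P[P─c] = proj₂ (A×P≐B*×P _) (MB.restrict⇒dual-contract (p⊆p∪q Q) c⊆P B∘P[P─c])

  A∘P⇒B×P : ∀ {c} → restrict A P c → contract (P ∪ Q) B P (P ─ c)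
  A∘P⇒B×P A∘Pc = MB.dual-restrict⇒contract (p⊆p∪q Q) (proj₁ (A∘P≐B*∘P _) A∘Pc)

  B×P⇒A∘P : ∀ {c} → c ⊆ P → contract (P ∪ Q) B P (P ─ c) → restrict A P c
  B×P⇒A∘P c⊆P B×P[P─c] = proj₂ (A∘P≐B*∘P _) (MB.contract⇒dual-restrict (p⊆p∪q Q) c⊆P B×P[P─c])

  A*∘P≐B∘P : restrict (dual (S ∪ P) A) P ≐ restrict B P
  A*∘P≐B∘P c = to , from
    where
    to : restrict (dual (S ∪ P) A) P c → restrict B P c
    to A*∘Pc = subst (restrict B P) (p─[p─q]≡q (restrict⊆ A*∘Pc))
                 (A×P⇒B∘P (MA.dual-restrict⇒contract (q⊆p∪q S P) A*∘Pc))
    from : restrict B P c → restrict (dual (S ∪ P) A) P c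
    from B∘Pc = MA.contract⇒dual-restrict (q⊆p∪q S P) c⊆P
                  (B∘P⇒A×P (p─q⊆p P c) (subst (restrict B P) (sym (p─[p─q]≡q c⊆P)) B∘Pc))
      where
      c⊆P : c ⊆ P
      c⊆P = restrict⊆ B∘Pc

  A*×P≐B×P : contract (S ∪ P) (dual (S ∪ P) A) P ≐ contract (P ∪ Q) B P
  A*×P≐B×P c = to , from
    where
    to : contract (S ∪ P) (dual (S ∪ P) A) P c → contract (P ∪ Q) B P c
    to A*×Pc = subst (contract (P ∪ Q) B P) (p─[p─q]≡q (contract⊆ A*×Pc))
                 (A∘P⇒B×P (MA.dual-contract⇒restrict (q⊆p∪q S P) A*×Pc))
    from : contract (P ∪ Q) B P c → contract (S ∪ P) (dual (S ∪ P) A) P c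
    from B×Pc = MA.restrict⇒dual-contract (q⊆p∪q S P) c⊆P
                  (B×P⇒A∘P (p─q⊆p P c) (subst (contract (P ∪ Q) B P) (sym (p─[p─q]≡q c⊆P)) B×Pc))
      where
      c⊆P : c ⊆ P
      c⊆P = contract⊆ B×Pc

  U : Family n
  U = union A B

  L : Family n
  L = contract (S ∪ P ∪ Q) U (S ∪ Q)

  U⇒L : ∀ {u} → U u → P ⊆ u → L (u ∩ (S ∪ Q))
  U⇒L {u} Uu P⊆u = u , Uu , subst-restrict∩ (sym S∪P∪Q─[S∪Q]≡P) maxP , refl
    where
    maxP : restrict U P (u ∩ P)
    maxP = base∩-IndepIn P Uu , λ d (_ , d⊆P) _ → p⊆q∧p⊆r⇒p⊆q∩r (P⊆u ∘ d⊆P) d⊆P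

  L⇒bases : ∀ {ℓ} → L ℓ → ∃ λ a → ∃ λ b → A a × B b × restrict U P ((a ∪ b) ∩ P) × ℓ ≡ (a ∪ b) ∩ (S ∪ Q)
  L⇒bases (_ , ((a , b , Aa , Bb , refl) , _) , maxP , ℓ≡) =
    a , b , Aa , Bb , subst-restrict∩ S∪P∪Q─[S∪Q]≡P maxP , ℓ≡

  ℓ∩S≡a∩S : ∀ {a b} → B b → ((a ∪ b) ∩ (S ∪ Q)) ∩ S ≡ a ∩ S
  ℓ∩S≡a∩S Bb = [p∪q]∩r∩s≡p∩s (p⊆p∪q Q) (b#S Bb)

  ℓ∩Q≡b∩Q : ∀ {a b} → A a → ((a ∪ b) ∩ (S ∪ Q)) ∩ Q ≡ b ∩ Q
  ℓ∩Q≡b∩Q {a} {b} Aa = trans (cong (λ u → (u ∩ (S ∪ Q)) ∩ Q) (∪-comm a b))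
                             ([p∪q]∩r∩s≡p∩s (q⊆p∪q S Q) (a#Q Aa))

  L-Indep⇒A-Indep : ∀ {d} → d ⊆ S → Indep L d → Indep A d
  L-Indep⇒A-Indep d⊆S (ℓ , Lℓ , d⊆ℓ) with L⇒bases Lℓ
  ... | a , _ , Aa , Bb , _ , refl =
    a , Aa , λ x∈d → p∩q⊆p a S (subst (_ ∈_) (ℓ∩S≡a∩S Bb) (x∈p∩q⁺ (d⊆ℓ x∈d , d⊆S x∈d)))

  L-Indep⇒B-Indep : ∀ {d} → d ⊆ Q → Indep L d → Indep B d
  L-Indep⇒B-Indep d⊆Q (ℓ , Lℓ , d⊆ℓ) with L⇒bases Lℓ
  ... | _ , b , Aa , Bb , _ , refl =
    b , Bb , λ x∈d → p∩q⊆p b Q (subst (_ ∈_) (ℓ∩Q≡b∩Q Aa) (x∈p∩q⁺ (d⊆ℓ x∈d , d⊆Q x∈d)))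

  -- Splitting P between them makes a and b disjoint.
  complementary⇒U : ∀ {a b} → A a → B b → P ─ (a ∩ P) ≡ b ∩ P → U (a ∪ b) × P ⊆ a ∪ b
  complementary⇒U {a} {b} Aa Bb P─a∩P≡b∩P = Disjoint-bases⇒union isA isB Aa Bb a#b , P⊆a∪b
    where
    a#b : Disjoint a b
    a#b {x} x∈a x∈b with x∈p∪q⁻ S P (IsMatroid.base⊆ground isA Aa x∈a)
    ... | inj₁ x∈S = b#S Bb x∈b x∈S
    ... | inj₂ x∈P = x∈p─q⇒x∉q (subst (x ∈_) (sym P─a∩P≡b∩P) (x∈p∩q⁺ (x∈b , x∈P))) (x∈p∩q⁺ (x∈a , x∈P))
    P⊆a∪b : P ⊆ a ∪ b
    P⊆a∪b {x} x∈P with x ∈? a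
    ... | yes x∈a = p⊆p∪q b x∈a
    ... | no  x∉a = q⊆p∪q a b (p∩q⊆p b P (subst (x ∈_) P─a∩P≡b∩P
                      (x∈p∧x∉q⇒x∈p─q x∈P λ x∈a∩P → x∉a (p∩q⊆p a P x∈a∩P))))

  A∘S⇒A×P : ∀ {m} → restrict A S m → ∃ λ a → A a × m ⊆ a × contract (S ∪ P) A P (a ∩ P)
  A∘S⇒A×P maxm with MA.restrict⇒base∩ maxm
  ... | a , Aa , m⊆a , _ = a , Aa , m⊆a , a , Aa , subst-restrict∩ (sym S∪P─P≡S) maxa∩S , refl
    where
    maxa∩S : restrict A S (a ∩ S)
    maxa∩S = Maximal-⊇ maxm (base∩-IndepIn S Aa) (p⊆q∧p⊆r⇒p⊆q∩r m⊆a (restrict⊆ maxm))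

  A∘S⇒U : ∀ {m} → restrict A S m → ∃ λ u → U u × P ⊆ u × m ⊆ u
  A∘S⇒U maxm with A∘S⇒A×P maxm
  ... | a , Aa , m⊆a , A×P[a∩P] with MB.restrict⇒base∩ (A×P⇒B∘P A×P[a∩P])
  ... | b , Bb , P─a∩P⊆b , b∩P⊆P─a∩P =
    let Ua∪b , P⊆a∪b = complementary⇒U Aa Bb (⊆-antisym (p⊆q∧p⊆r⇒p⊆q∩r P─a∩P⊆b (p─q⊆p P _)) b∩P⊆P─a∩P)
    in a ∪ b , Ua∪b , P⊆a∪b , p⊆p∪q b ∘ m⊆a

  A∘S⇒L-Indep : ∀ {m} → restrict A S m → Indep L m
  A∘S⇒L-Indep maxm with A∘S⇒U maxm
  ... | u , Uu , P⊆u , m⊆u =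
    u ∩ (S ∪ Q) , U⇒L Uu P⊆u , λ x∈m → x∈p∩q⁺ (m⊆u x∈m , p⊆p∪q Q (restrict⊆ maxm x∈m))

  -- P is independent in U (A∘S⇒U applied to any base of A ∘ S), so a base of U ∘ P is all of P.
  U∘P⇒P⊆ : ∀ {u} → restrict U P (u ∩ P) → P ⊆ u
  U∘P⇒P⊆ {u} (_ , max) = decidable-stable (P ⊆? u) λ P⊈u →
    ¬¬-Maximal-⊇ (IndepIn A S) ∅-IndepIn λ (m , maxm , _) →
      let v , Uv , P⊆v , _ = A∘S⇒U maxm
      in P⊈u (λ x∈P → p∩q⊆p u P (max P ((v , Uv , P⊆v) , ⊆-refl) (p∩q⊆q u P) x∈P))
    where
    ∅-IndepIn : IndepIn A S ⊥
    ∅-IndepIn = let a , Aa = IsMatroid.base-exists isA in (a , Aa , ⊥⊆) , ⊥⊆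

  L∘S≐A∘S : restrict L S ≐ restrict A S
  L∘S≐A∘S c = to , from
    where
    to : restrict L S c → restrict A S c
    to ((ILc , c⊆S) , max) = (L-Indep⇒A-Indep c⊆S ILc , c⊆S) , λ d (IAd , d⊆S) c⊆d →
      decidable-stable (d ⊆? c) λ d⊈c → ¬¬-Maximal-⊇ (IndepIn A S) (IAd , d⊆S) λ (m , maxm , d⊆m) →
        d⊈c (max d (Indep-⊆ (A∘S⇒L-Indep maxm) d⊆m , d⊆S) c⊆d)
    from : restrict A S c → restrict L S c
    from maxc = Maximal-transfer maxc (A∘S⇒L-Indep maxc , λ {_} → restrict⊆ maxc)
                  λ (ILd , d⊆S) → L-Indep⇒A-Indep d⊆S ILd , d⊆S

  A×S⇒L×S : ∀ {c} → contract (S ∪ P) A S c → contract (S ∪ Q) L S c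
  A×S⇒L×S (a , Aa , maxa∩P , refl) with A∘P⇒B×P (subst-restrict∩ S∪P─S≡P maxa∩P)
  ... | b , Bb , maxb∩Q , P─a∩P≡b∩P with complementary⇒U Aa Bb P─a∩P≡b∩P
  ... | Ua∪b , P⊆a∪b = ℓ , Lℓ , subst-restrict∩ (sym S∪Q─S≡Q) maxℓ∩Q , sym (ℓ∩S≡a∩S Bb)
    where
    ℓ : Subset n
    ℓ = (a ∪ b) ∩ (S ∪ Q)
    Lℓ : L ℓ
    Lℓ = U⇒L Ua∪b P⊆a∪b
    maxℓ∩Q : restrict L Q (ℓ ∩ Q)
    maxℓ∩Q = Maximal-transfer (subst (restrict B Q) (sym (ℓ∩Q≡b∩Q Aa)) (subst-restrict∩ P∪Q─P≡Q maxb∩Q))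
               (base∩-IndepIn Q Lℓ) λ (ILd , d⊆Q) → L-Indep⇒B-Indep d⊆Q ILd , d⊆Q

  L×S⇒A×S : restrict L Q ≐ restrict B Q → ∀ {c} → contract (S ∪ Q) L S c → contract (S ∪ P) A S c
  L×S⇒A×S L∘Q≐B∘Q (ℓ , Lℓ , maxℓ∩Q , refl) with L⇒bases Lℓ
  ... | a , b , Aa , Bb , maxP , refl = a , Aa , subst-restrict∩ (sym S∪P─S≡P) maxa∩P , ℓ∩S≡a∩S Bb
    where
    maxb∩Q : restrict B Q (b ∩ Q)
    maxb∩Q = subst (restrict B Q) (ℓ∩Q≡b∩Q Aa) (proj₁ (L∘Q≐B∘Q _) (subst-restrict∩ S∪Q─S≡Q maxℓ∩Q))
    B×P[b∩P] : contract (P ∪ Q) B P (P ─ (P ─ (b ∩ P)))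
    B×P[b∩P] = subst (contract (P ∪ Q) B P) (sym (p─[p─q]≡q (p∩q⊆q b P)))
                 (b , Bb , subst-restrict∩ (sym P∪Q─P≡Q) maxb∩Q , refl)
    P─b∩P⊆a∩P : P ─ (b ∩ P) ⊆ a ∩ P
    P─b∩P⊆a∩P x∈ with x∈p─q⁻ P (b ∩ P) x∈
    ... | x∈P , x∉b∩P with x∈p∪q⁻ a b (U∘P⇒P⊆ maxP x∈P)
    ...   | inj₁ x∈a = x∈p∩q⁺ (x∈a , x∈P)
    ...   | inj₂ x∈b = ⊥-elim (x∉b∩P (x∈p∩q⁺ (x∈b , x∈P)))
    maxa∩P : restrict A P (a ∩ P)
    maxa∩P = Maximal-⊇ (B×P⇒A∘P (p─q⊆p P _) B×P[b∩P]) (base∩-IndepIn P Aa) P─b∩P⊆a∩P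

  private
    link≐L : link S P Q A B ≐ L
    link≐L = link≐contract-union S P Q A B

  link∘S≐A∘S : restrict (link S P Q A B) S ≐ restrict A S
  link∘S≐A∘S = ≐-trans (restrict-≐ S link≐L) L∘S≐A∘S

  link×S≐A×S : restrict (link S P Q A B) Q ≐ restrict B Q →
               contract (S ∪ Q) (link S P Q A B) S ≐ contract (S ∪ P) A S
  link×S≐A×S link∘Q≐B∘Q = ≐-trans (contract-≐ (S ∪ Q) S link≐L) λ _ →
    L×S⇒A×S (≐-trans (restrict-≐ Q (≐-sym link≐L)) link∘Q≐B∘Q) , A×S⇒L×S

lemma19 : {n : ℕ} (S P Q : Subset n) (MSP MPQ : Family n) →
    S ∩ P ≡ ⊥ → P ∩ Q ≡ ⊥ → S ∩ Q ≡ ⊥ →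
    IsMatroid (S ∪ P) MSP → IsMatroid (P ∪ Q) MPQ →
    restrict MSP P ≐ restrict (dual (P ∪ Q) MPQ) P →
    contract (S ∪ P) MSP P ≐ contract (P ∪ Q) (dual (P ∪ Q) MPQ) P →
    ((restrict (link S P Q MSP MPQ) S ≐ restrict MSP S)
      × (contract (S ∪ Q) (link S P Q MSP MPQ) S ≐ contract (S ∪ P) MSP S))
    × ((restrict (dual (S ∪ P) MSP) P ≐ restrict MPQ P)
      × (contract (S ∪ P) (dual (S ∪ P) MSP) P ≐ contract (P ∪ Q) MPQ P)
      × (restrict (link S P Q MSP MPQ) Q ≐ restrict MPQ Q)
      × (contract (S ∪ Q) (link S P Q MSP MPQ) Q ≐ contract (P ∪ Q) MPQ Q))
lemma19 S P Q A B S∩P≡⊥ P∩Q≡⊥ S∩Q≡⊥ isA isB A∘P≐B*∘P A×P≐B*×P =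
  (SQ.link∘S≐A∘S , SQ.link×S≐A×S link∘Q≐B∘Q) ,
  (SQ.A*∘P≐B∘P , SQ.A*×P≐B×P , link∘Q≐B∘Q , link×Q≐B×Q)
  where
  S#P : Disjoint S P
  S#P = ∩≡⊥⇒Disjoint S∩P≡⊥
  P#Q : Disjoint P Q
  P#Q = ∩≡⊥⇒Disjoint P∩Q≡⊥
  S#Q : Disjoint S Q
  S#Q = ∩≡⊥⇒Disjoint S∩Q≡⊥
  module SQ = Linking S#P P#Q S#Q isA isB A∘P≐B*∘P A×P≐B*×P
  -- the same situation read from Q to S, its hypotheses supplied by part (ii) on the S side
  module QS = Linking (Disjoint-sym P#Q) (Disjoint-sym S#P) (Disjoint-sym S#Q)
    (subst (λ X → IsMatroid X B) (∪-comm P Q) isB) (subst (λ X → IsMatroid X A) (∪-comm S P) isA)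
    (≐-sym (subst (λ X → restrict (dual X A) P ≐ restrict B P) (∪-comm S P) SQ.A*∘P≐B∘P))
    (≐-sym (subst₂ (λ X Y → contract X (dual X A) P ≐ contract Y B P) (∪-comm S P) (∪-comm P Q) SQ.A*×P≐B×P))
  link∘Q≐B∘Q : restrict (link S P Q A B) Q ≐ restrict B Q
  link∘Q≐B∘Q = ≐-trans (restrict-≐ Q (≐-sym (link-comm S P Q A B))) QS.link∘S≐A∘S
  link×Q≐B×Q : contract (S ∪ Q) (link S P Q A B) Q ≐ contract (P ∪ Q) B Q
  link×Q≐B×Q = subst₂ (λ X Y → contract X (link S P Q A B) Q ≐ contract Y B Q) (∪-comm Q S) (∪-comm Q P)
    (≐-trans (contract-≐ (Q ∪ S) Q (≐-sym (link-comm S P Q A B)))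
             (QS.link×S≐A×S (≐-trans (restrict-≐ S (link-comm S P Q A B)) SQ.link∘S≐A∘S)))
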